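{- Let $\sigma^{:}$ and $\pi^{:}$ be decorated permutations on $[n]$ with $\operatorname{rk}(\sigma^{:})=\operatorname{rk}(\pi^{:})-1$. Then $\sigma^{:}=\overrightarrow{\rho_A}(\pi^{:})$ for some $A\subseteq[n]$ if and only if the shift intervals $S^{\pi,\sigma}_1,\dots,S^{\pi,\sigma}_n$ are pairwise disjoint with union $[n]$ (i.e. $\bigsqcup_{i=1}^n S^{\pi,\sigma}_i=[n]$ as a multiset union).
   Context: For $i\in[n]$ the cyclic order $<_i$ is $i<_i i+1<_i\cdots<_i n<_i 1<_i\cdots<_i i-1$. A decorated permutation on $[n]$ is a pair $(\pi,\operatorname{col})$, $\pi$ a permutation of $[n]$, $\operatorname{col}:[n]\to\{0,1,-1\}$ with $\operatorname{col}(i)=0$ iff $\pi(i)\ne i$ (fixed points with $\operatorname{col}=1$ are loops, with $\operatorname{col}=-1$ coloops). Its rank is $\operatorname{rk}(\pi^{:})=|\{j: j<_1\pi^{ -1}(j)\text{ or }\operatorname{col}(j)=-1\}|$. For $a,b\in[n]$ the cyclic interval $(a,b]$ is $\{a+1,\dots,b\}$ (indices mod $n$), with $(a,a]=\emptyset$. Shift interval: $S^{\pi,\sigma}_i=(\pi^{ -1}(i),\sigma^{ -1}(i)]$, except $S^{\pi,\sigma}_i=[n]$ when $i$ is a loop of $\sigma^{:}$ and a coloop of $\pi^{:}$. Cyclic shift: for $A\subseteq[n]$, $\overrightarrow{\rho_A}(\pi,\operatorname{col}_\pi)=(\sigma,\operatorname{col}_\sigma)$ where for $i\in A$, $\sigma(i)=\pi(i)$,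 $\operatorname{col}_\sigma(i)=\operatorname{col}_\pi(i)$; for $i\notin A$, $\sigma(i)=\pi(j)$ with $j$ the maximum element of $[n]\setminus A$ under $<_i$, and $\operatorname{col}_\sigma(i)=1$ if $\sigma(i)=i$, else $0$. -}

module Defs where

open import Data.Nat using (ℕ; zero; suc; _+_; _∸_; _≤_; _<_; _≤ᵇ_; _<ᵇ_)
open import Data.Bool using (Bool; true; false; _∨_; _∧_; if_then_else_)
open import Data.Fin using (Fin; toℕ)
open import Data.Fin.Properties using (_≟_)
open import Data.Fin.Subset using (Subset; _∈_; _∉_)
open import Data.Fin.Permutation using (Permutation′; _⟨$⟩ʳ_; _⟨$⟩ˡ_)
open import Data.List using (List; []; _∷_; allFin)
open import Data.Product using (Σ; ∃; _×_; _,_)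
open import Data.Sum using (_⊎_)
open import Relation.Nullary using (¬_; does)
open import Relation.Binary.PropositionalEquality using (_≡_; _≢_)
open import Function.Bundles using (_⇔_)

-- Convention: [n] is represented by Fin n, with toℕ i = i - 1
-- (so Fin element 0 is 1 ∈ [n], etc.).

data Col : Set where
  c0  : Col
  c+1 : Col
  c-1 : Col

record DecPerm (n : ℕ) : Set where
  field
    perm   : Permutation′ n
    col    : Fin n → Col
    col-ok : ∀ i → (col i ≡ c0) ⇔ (perm ⟨$⟩ʳ i ≢ i)
open DecPerm public

_$ₚ_ : ∀ {n} → DecPerm n → Fin n → Fin n
π $ₚ i = perm π ⟨$⟩ʳ i

_⁻¹$ₚ_ : ∀ {n} → DecPerm n → Fin n → Fin n
π ⁻¹$ₚ i = perm π ⟨$⟩ˡ i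

isLoop : ∀ {n} → DecPerm n → Fin n → Set
isLoop π i = col π i ≡ c+1

isColoop : ∀ {n} → DecPerm n → Fin n → Set
isColoop π i = col π i ≡ c-1

-- position of j in the cyclic order <_i : i ↦ 0, i+1 ↦ 1, ..., i-1 ↦ n-1
pos : ∀ {n} → Fin n → Fin n → ℕ
pos {n} i j with toℕ i ≤ᵇ toℕ j
... | true  = toℕ j ∸ toℕ i
... | false = (n ∸ toℕ i) + toℕ j

_<[_]_ : ∀ {n} → Fin n → Fin n → Fin n → Set
j <[ i ] k = pos i j < pos i k

_≤[_]_ : ∀ {n} → Fin n → Fin n → Fin n → Set
j ≤[ i ] k = pos i j ≤ pos i k

countL : ∀ {n} → (Fin n → Bool) → List (Fin n) → ℕ
countL p [] = 0
countL p (x ∷ xs) = if p x then suc (countL p xs) else countL p xs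

count : ∀ {n} → (Fin n → Bool) → ℕ
count {n} p = countL p (allFin n)

isColoopᵇ : Col → Bool
isColoopᵇ c-1 = true
isColoopᵇ _   = false

-- rk(π) = |{ j : j <_1 π⁻¹(j) or col(j) = -1 }|
-- (the order <_1 is the usual order on [n], i.e. on toℕ)
rk : ∀ {n} → DecPerm n → ℕ
rk π = count (λ j → (toℕ j <ᵇ toℕ (π ⁻¹$ₚ j)) ∨ isColoopᵇ (col π j))

-- cyclic interval (a,b] = {a+1, ..., b}; empty when a = b
_∈⟨_,_] : ∀ {n} → Fin n → Fin n → Fin n → Set
k ∈⟨ a , b ] = (0 < pos a k) × (pos a k ≤ pos a b)

_∈S[_,_]_ : ∀ {n} → Fin n → DecPerm n → DecPerm n → Fin n → Set
k ∈S[ π , σ ] i =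
  (isLoop σ i × isColoop π i)
  ⊎ (¬ (isLoop σ i × isColoop π i) × (k ∈⟨ π ⁻¹$ₚ i , σ ⁻¹$ₚ i ]))

ShiftIntervalsPartition : ∀ {n} → DecPerm n → DecPerm n → Set
ShiftIntervalsPartition {n} π σ =
  (∀ i j k → k ∈S[ π , σ ] i → k ∈S[ π , σ ] j → i ≡ j)
  × (∀ (k : Fin n) → ∃ λ i → k ∈S[ π , σ ] i)

IsCyclicShift : ∀ {n} → Subset n → DecPerm n → DecPerm n → Set
IsCyclicShift A π σ =
  ∀ i →
    (i ∈ A → (σ $ₚ i ≡ π $ₚ i) × (col σ i ≡ col π i))
    × (i ∉ A →
        ∃ λ j → (j ∉ A)
              × (∀ k → k ∉ A → k ≤[ i ] j)
              × (σ $ₚ i ≡ π $ₚ j)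
              × (col σ i ≡ (if does (σ $ₚ i ≟ i) then c+1 else c0)))

-- Write pos a k for the cyclic distance from a to k, so that (a, b] has pos a b elements.
-- If σ = ρ_A(π), then π⁻¹(σ i) is, for i ∉ A, the last element of ∁A before i, so the nonempty
-- shift intervals are the arcs into which ∁A cuts the circle; the rank condition rules out A = [n],
-- and when ∁A = {c} it forces c to be a coloop of π that becomes a loop of σ, with S_c = [n].
-- Conversely, the step lengths pos (π⁻¹ v) v, plus n for each coloop, add up to n · rk π, and by
-- the triangle inequality the step of π at v is at most |S_v| plus the step of σ at v. When the
-- shift intervals partition [n], summing gives n · rk π = n + n · rk σ on both sides, so every
-- such inequality is an equality; this determines the colours at fixed points and shows that
-- σ = ρ_A(π) for A = {i : π i = σ i, unless σ i is a loop of σ and a coloop of π}.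

module Submission where

open import Defs
open import Data.Nat using (ℕ; zero; suc; _+_; _*_; _∸_; _≤_; _<_; _≤ᵇ_; _<ᵇ_; z≤n; s≤s; s≤s⁻¹)
open import Data.Nat.Properties hiding (_≟_; 0≢1+n; suc-injective)
open import Data.Bool using (Bool; true; false; T; if_then_else_; _∨_)
open import Data.Bool.Properties using (∨-zeroʳ; ∨-identityʳ)
open import Data.Unit using (tt)
open import Data.Fin using (Fin; zero; suc; toℕ; fromℕ<)
open import Data.Fin.Properties using (_≟_; 0≢1+n; suc-injective; toℕ-injective; toℕ<n; toℕ-fromℕ<; any?; all?; ¬∀⟶∃¬)
open import Data.Fin.Subset using (Subset; _∈_; _∉_)
open import Data.Fin.Subset.Properties using (_∈?_)
open import Data.Fin.Permutation using (inverseˡ; inverseʳ; flip)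
open import Data.List using (tabulate)
import Data.Vec as Vec
open import Data.Vec.Properties using (lookup∘tabulate; []=⇒lookup; lookup⇒[]=)
open import Data.Product using (Σ; ∃; _×_; _,_; proj₁; proj₂)
open import Data.Sum using (_⊎_; inj₁; inj₂)
open import Data.Empty using (⊥-elim)
open import Relation.Nullary using (¬_; yes; no; Dec; does)
open import Relation.Nullary.Decidable using (_×-dec_; _⊎-dec_; ¬?; dec-true; dec-false)
open import Relation.Unary using (Decidable)
open import Relation.Binary.PropositionalEquality
open import Function using (_∘_; case_of_)
open import Function.Bundles using (_⇔_; mk⇔; Equivalence)
import Data.Nat as ℕ
open import Data.Nat.Tactic.RingSolver using (solve-∀)
open import Algebra.Properties.CommutativeMonoid.Sum +-0-commutativeMonoid
  using (sum; sum-cong-≗; sum-replicate-zero; ∑-comm; ∑-distrib-+; ∑-permute)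
open import Algebra.Properties.Semiring.Sum +-*-semiring using (*-distribˡ-sum)

𝟙 : Bool → ℕ
𝟙 true  = 1
𝟙 false = 0

χ : ∀ {p} {P : Set p} → Dec P → ℕ
χ = 𝟙 ∘ does

χ-yes : ∀ {p} {P : Set p} (P? : Dec P) → P → χ P? ≡ 1
χ-yes P? = cong 𝟙 ∘ dec-true P?

χ-no : ∀ {p} {P : Set p} (P? : Dec P) → ¬ P → χ P? ≡ 0
χ-no P? = cong 𝟙 ∘ dec-false P?

χ-cong : ∀ {p q} {P : Set p} {Q : Set q} (P? : Dec P) (Q? : Dec Q) → (P → Q) → (Q → P) → χ P? ≡ χ Q?
χ-cong (yes p) Q? to from = sym (χ-yes Q? (to p))
χ-cong (no ¬p) Q? to from = sym (χ-no Q? (¬p ∘ from))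

sum-ones : ∀ n → sum {n} (λ _ → 1) ≡ n
sum-ones zero    = refl
sum-ones (suc n) = cong suc (sum-ones n)

sum-mono-≤ : ∀ {n} {f g : Fin n → ℕ} → (∀ i → f i ≤ g i) → sum f ≤ sum g
sum-mono-≤ {zero}  f≤g = z≤n
sum-mono-≤ {suc n} f≤g = +-mono-≤ (f≤g zero) (sum-mono-≤ (f≤g ∘ suc))

+-mono-≤-≡⇒≡ : ∀ {a b c d} → a ≤ b → c ≤ d → a + c ≡ b + d → a ≡ b × c ≡ d
+-mono-≤-≡⇒≡ {a} {b} {c} {d} a≤b c≤d eq = a≡b , +-cancelˡ-≡ a c d (trans eq (cong (_+ d) (sym a≡b)))
  where
  a≡b : a ≡ b
  a≡b = ≤-antisym a≤b (+-cancelʳ-≤ c b a (subst (b + c ≤_) (sym eq) (+-monoʳ-≤ b c≤d)))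

sum-mono-≤-≡⇒≗ : ∀ {n} {f g : Fin n → ℕ} → (∀ i → f i ≤ g i) → sum f ≡ sum g → ∀ i → f i ≡ g i
sum-mono-≤-≡⇒≗ {suc n} f≤g eq with +-mono-≤-≡⇒≡ (f≤g zero) (sum-mono-≤ (f≤g ∘ suc)) eq
... | head , tail = λ { zero → head ; (suc i) → sum-mono-≤-≡⇒≗ (f≤g ∘ suc) tail i }

sum-χ-unique : ∀ {n p} {P : Fin n → Set p} (P? : Decidable P) {i₀} → P i₀ → (∀ i → P i → i ≡ i₀) →
  sum (χ ∘ P?) ≡ 1
sum-χ-unique {suc n} P? {zero} p₀ unique =
  cong₂ _+_ (χ-yes (P? zero) p₀)
    (trans (sum-cong-≗ (λ i → χ-no (P? (suc i)) (0≢1+n ∘ sym ∘ unique (suc i)))) (sum-replicate-zero n))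
sum-χ-unique {suc n} P? {suc i₀} pᵢ₀ unique =
  cong₂ _+_ (χ-no (P? zero) (0≢1+n ∘ unique zero))
    (sum-χ-unique (P? ∘ suc) pᵢ₀ (λ i → suc-injective ∘ unique (suc i)))

countL-tabulate : ∀ {n m} (p : Fin n → Bool) (f : Fin m → Fin n) → countL p (tabulate f) ≡ sum (𝟙 ∘ p ∘ f)
countL-tabulate {m = zero}  p f = refl
countL-tabulate {m = suc m} p f with p (f zero)
... | true  = cong suc (countL-tabulate p (f ∘ suc))
... | false = countL-tabulate p (f ∘ suc)

count≡sum : ∀ {n} (p : Fin n → Bool) → count p ≡ sum (𝟙 ∘ p)
count≡sum p = countL-tabulate p (λ i → i)

argmin : ∀ {n p} {P : Fin n → Set p} → Decidable P → (f : Fin n → ℕ) → ∃ P →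
  ∃ λ c → P c × (∀ x → P x → f c ≤ f x)
argmin {suc n} {P = P} P? f (x , px) with any? (P? ∘ suc)
... | no ¬tail = zero , p₀ x px , λ { zero _ → ≤-refl ; (suc y) py → ⊥-elim (¬tail (y , py)) }
  where
  p₀ : ∀ x → P x → P zero
  p₀ zero    px = px
  p₀ (suc y) py = ⊥-elim (¬tail (y , py))
... | yes tail with argmin (P? ∘ suc) (f ∘ suc) tail | P? zero
...   | c , pc , min | no ¬p₀ = suc c , pc , λ { zero p₀ → ⊥-elim (¬p₀ p₀) ; (suc y) py → min y py }
...   | c , pc , min | yes p₀ with f zero ≤? f (suc c)
...     | yes le = zero , p₀ , λ { zero _ → ≤-refl ; (suc y) py → ≤-trans le (min y py) }
...     | no ¬le = suc c , pc , λ { zero _ → <⇒≤ (≰⇒> ¬le) ; (suc y) py → min y py }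

-- pos a k is the unique d < n with d + a ≡ k modulo n; the wrap w makes this an equation in ℕ.
Wrap : ℕ → ℕ → Set
Wrap n w = w ≡ 0 ⊎ w ≡ n

IsCyclicDistance : ℕ → ℕ → ℕ → ℕ → Set
IsCyclicDistance n a k d = d < n × ∃ λ w → Wrap n w × d + a ≡ k + w

<⇒≢+ : ∀ {n d} m → d < n → d ≢ m + n
<⇒≢+ m d<n refl = m+n≮n m _ d<n

cyclicDistance-unique : ∀ {n a k d d′} → IsCyclicDistance n a k d → IsCyclicDistance n a k d′ → d ≡ d′
cyclicDistance-unique {a = a} (_ , _ , inj₁ refl , e) (_ , _ , inj₁ refl , e′) = +-cancelʳ-≡ a _ _ (trans e (sym e′))
cyclicDistance-unique {a = a} (_ , _ , inj₂ refl , e) (_ , _ , inj₂ refl , e′) = +-cancelʳ-≡ a _ _ (trans e (sym e′))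
cyclicDistance-unique {n} {a} {k} {d} {d′} (_ , _ , inj₁ refl , e) (d′<n , _ , inj₂ refl , e′) =
  ⊥-elim (<⇒≢+ d d′<n (+-cancelʳ-≡ a _ _ (begin
    d′ + a       ≡⟨ e′ ⟩
    k + n        ≡⟨ cong (_+ n) (trans (sym (+-identityʳ k)) (sym e)) ⟩
    d + a + n    ≡⟨ +-comm-middle d a n ⟩
    d + n + a    ∎)))
  where
  open ≡-Reasoning
  +-comm-middle : ∀ d a n → d + a + n ≡ d + n + a
  +-comm-middle = solve-∀
cyclicDistance-unique (d<n , w , inj₂ refl , e) (d′<n , w′ , inj₁ refl , e′) =
  sym (cyclicDistance-unique (d′<n , w′ , inj₁ refl , e′) (d<n , w , inj₂ refl , e))

wrap-cancel : ∀ {n s d w₁ w₂ w₃} → s < n + n → d < n → Wrap n w₁ → Wrap n w₂ → Wrap n w₃ →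
  s + w₂ ≡ d + (w₁ + w₃) → s ≡ d ⊎ s ≡ d + n
wrap-cancel {n} {s} {d} _ _ (inj₁ refl) (inj₁ refl) (inj₁ refl) e =
  inj₁ (trans (sym (+-identityʳ s)) (trans e (+-identityʳ d)))
wrap-cancel {n} {s} {d} _ _ (inj₁ refl) (inj₁ refl) (inj₂ refl) e = inj₂ (trans (sym (+-identityʳ s)) e)
wrap-cancel {n} {s} {d} _ _ (inj₂ refl) (inj₁ refl) (inj₁ refl) e =
  inj₂ (trans (sym (+-identityʳ s)) (trans e (cong (d +_) (+-identityʳ n))))
wrap-cancel {n} {s} {d} s<2n _ (inj₂ refl) (inj₁ refl) (inj₂ refl) e =
  ⊥-elim (m+n≮n d (n + n) (subst (_< n + n) (trans (sym (+-identityʳ s)) e) s<2n))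
wrap-cancel {n} {s} {d} _ d<n (inj₁ refl) (inj₂ refl) (inj₁ refl) e =
  ⊥-elim (m+n≮n s n (subst (_< n) (sym (trans e (+-identityʳ d))) d<n))
wrap-cancel {n} {s} {d} _ _ (inj₁ refl) (inj₂ refl) (inj₂ refl) e = inj₁ (+-cancelʳ-≡ n s d e)
wrap-cancel {n} {s} {d} _ _ (inj₂ refl) (inj₂ refl) (inj₁ refl) e =
  inj₁ (+-cancelʳ-≡ n s d (trans e (cong (d +_) (+-identityʳ n))))
wrap-cancel {n} {s} {d} _ _ (inj₂ refl) (inj₂ refl) (inj₂ refl) e =
  inj₂ (+-cancelʳ-≡ n s (d + n) (trans e (sym (+-assoc d n n))))

cyclicDistance-trans : ∀ {n a b x d₁ d₂ d₃} →
  IsCyclicDistance n a b d₁ → IsCyclicDistance n b x d₃ → IsCyclicDistance n a x d₂ →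
  d₁ + d₃ ≡ d₂ ⊎ d₁ + d₃ ≡ d₂ + n
cyclicDistance-trans {n} {a} {b} {x} {d₁} {d₂} {d₃}
  (d₁<n , w₁ , wrap₁ , e₁) (d₃<n , w₃ , wrap₃ , e₃) (d₂<n , w₂ , wrap₂ , e₂) =
  wrap-cancel (+-mono-< d₁<n d₃<n) d₂<n wrap₁ wrap₂ wrap₃ (+-cancelʳ-≡ (a + b + x) _ _ (begin
    d₁ + d₃ + w₂ + (a + b + x)        ≡⟨ regroup₁ d₁ d₃ w₂ a b x ⟩
    (d₁ + a) + (d₃ + b) + (w₂ + x)    ≡⟨ cong₂ (λ u v → u + v + (w₂ + x)) e₁ e₃ ⟩
    (b + w₁) + (x + w₃) + (w₂ + x)    ≡⟨ regroup₂ b w₁ x w₃ w₂ ⟩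
    (x + w₂) + w₁ + w₃ + b + x        ≡⟨ cong (λ u → u + w₁ + w₃ + b + x) (sym e₂) ⟩
    (d₂ + a) + w₁ + w₃ + b + x        ≡⟨ regroup₃ d₂ a w₁ w₃ b x ⟩
    d₂ + (w₁ + w₃) + (a + b + x)      ∎))
  where
  open ≡-Reasoning
  regroup₁ : ∀ d₁ d₃ w₂ a b x → d₁ + d₃ + w₂ + (a + b + x) ≡ (d₁ + a) + (d₃ + b) + (w₂ + x)
  regroup₁ = solve-∀
  regroup₂ : ∀ b w₁ x w₃ w₂ → (b + w₁) + (x + w₃) + (w₂ + x) ≡ (x + w₂) + w₁ + w₃ + b + x
  regroup₂ = solve-∀
  regroup₃ : ∀ d₂ a w₁ w₃ b x → (d₂ + a) + w₁ + w₃ + b + x ≡ d₂ + (w₁ + w₃) + (a + b + x)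
  regroup₃ = solve-∀

χ-range-suc : ∀ d m → χ ((0 <? d) ×-dec (d ≤? suc m)) ≡ χ ((0 <? d) ×-dec (d ≤? m)) + χ (d ℕ.≟ suc m)
χ-range-suc d m with d ℕ.≟ suc m
... | yes refl = trans (χ-yes ((0 <? d) ×-dec (d ≤? suc m)) (s≤s z≤n , ≤-refl))
  (sym (cong₂ _+_ (χ-no ((0 <? d) ×-dec (d ≤? m)) (λ (_ , 1+m≤m) → n≮n m 1+m≤m)) (χ-yes (d ℕ.≟ d) refl)))
... | no d≢1+m = trans (χ-cong ((0 <? d) ×-dec (d ≤? suc m)) ((0 <? d) ×-dec (d ≤? m)) shrink grow)
                       (sym (trans (cong (χ ((0 <? d) ×-dec (d ≤? m)) +_) (χ-no (d ℕ.≟ suc m) d≢1+m)) (+-identityʳ _)))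
  where
  shrink : 0 < d × d ≤ suc m → 0 < d × d ≤ m
  shrink (0<d , d≤1+m) with m≤n⇒m<n∨m≡n d≤1+m
  ... | inj₁ d<1+m = 0<d , s≤s⁻¹ d<1+m
  ... | inj₂ d≡1+m = ⊥-elim (d≢1+m d≡1+m)
  grow : 0 < d × d ≤ m → 0 < d × d ≤ suc m
  grow (0<d , d≤m) = 0<d , m≤n⇒m≤1+n d≤m

module _ {n : ℕ} where

  pos-isCyclicDistance : ∀ (a k : Fin n) → IsCyclicDistance n (toℕ a) (toℕ k) (pos a k)
  pos-isCyclicDistance a k with toℕ a ≤ᵇ toℕ k in eq
  ... | true  = ≤-<-trans (m∸n≤m (toℕ k) (toℕ a)) (toℕ<n k) , 0 , inj₁ refl ,
                trans (m∸n+n≡m (≤ᵇ⇒≤ (toℕ a) (toℕ k) (subst T (sym eq) tt))) (sym (+-identityʳ _))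
  ... | false = wrapped< , n , inj₂ refl , wrapped≡
    where
    k<a : toℕ k < toℕ a
    k<a = ≰⇒> (λ a≤k → subst T eq (≤⇒≤ᵇ a≤k))
    a≤n : toℕ a ≤ n
    a≤n = <⇒≤ (toℕ<n a)
    wrapped< : n ∸ toℕ a + toℕ k < n
    wrapped< = subst (n ∸ toℕ a + toℕ k <_) (m∸n+n≡m a≤n) (+-monoʳ-< (n ∸ toℕ a) k<a)
    wrapped≡ : n ∸ toℕ a + toℕ k + toℕ a ≡ toℕ k + n
    wrapped≡ = begin
      n ∸ toℕ a + toℕ k + toℕ a   ≡⟨ +-assoc (n ∸ toℕ a) (toℕ k) (toℕ a) ⟩
      n ∸ toℕ a + (toℕ k + toℕ a) ≡⟨ cong (n ∸ toℕ a +_) (+-comm (toℕ k) (toℕ a)) ⟩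
      n ∸ toℕ a + (toℕ a + toℕ k) ≡⟨ +-assoc (n ∸ toℕ a) (toℕ a) (toℕ k) ⟨
      n ∸ toℕ a + toℕ a + toℕ k   ≡⟨ cong (_+ toℕ k) (m∸n+n≡m a≤n) ⟩
      n + toℕ k                   ≡⟨ +-comm n (toℕ k) ⟩
      toℕ k + n                   ∎
      where open ≡-Reasoning

  pos<n : ∀ (a k : Fin n) → pos a k < n
  pos<n a k = proj₁ (pos-isCyclicDistance a k)

  pos-refl : ∀ (a : Fin n) → pos a a ≡ 0
  pos-refl a = cyclicDistance-unique (pos-isCyclicDistance a a)
    (≤-<-trans z≤n (toℕ<n a) , 0 , inj₁ refl , sym (+-identityʳ _))

  pos≡0⇒≡ : ∀ {a k : Fin n} → pos a k ≡ 0 → a ≡ k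
  pos≡0⇒≡ {a} {k} eq with pos-isCyclicDistance a k
  ... | _ , _ , inj₁ refl , e = toℕ-injective (trans (subst (λ d → d + toℕ a ≡ toℕ k + 0) eq e) (+-identityʳ _))
  ... | _ , _ , inj₂ refl , e = ⊥-elim (<⇒≢+ (toℕ k) (toℕ<n a) (subst (λ d → d + toℕ a ≡ toℕ k + n) eq e))

  pos-triangle : ∀ (a b x : Fin n) → pos a b + pos b x ≡ pos a x ⊎ pos a b + pos b x ≡ pos a x + n
  pos-triangle a b x = cyclicDistance-trans (pos-isCyclicDistance a b) (pos-isCyclicDistance b x) (pos-isCyclicDistance a x)

  pos-+-≤ : ∀ (a b x : Fin n) → pos a b ≤ pos a x → pos a b + pos b x ≡ pos a x
  pos-+-≤ a b x ab≤ax with pos-triangle a b x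
  ... | inj₁ e = e
  ... | inj₂ e = ⊥-elim (<⇒≱ (pos<n b x) (+-cancelˡ-≤ (pos a b) n (pos b x)
                   (subst (pos a b + n ≤_) (sym e) (+-monoˡ-≤ n ab≤ax))))

  pos-+-> : ∀ (a b x : Fin n) → pos a x < pos a b → pos a b + pos b x ≡ pos a x + n
  pos-+-> a b x ax<ab with pos-triangle a b x
  ... | inj₂ e = e
  ... | inj₁ e = ⊥-elim (<⇒≱ ax<ab (subst (pos a b ≤_) e (m≤m+n _ _)))

  pos-≤-+ : ∀ (a b x : Fin n) → pos a x ≤ pos a b + pos b x
  pos-≤-+ a b x with pos-triangle a b x
  ... | inj₁ e = ≤-reflexive (sym e)
  ... | inj₂ e = ≤-trans (m≤m+n _ n) (≤-reflexive (sym e))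

  pos-+-pos : ∀ {a k : Fin n} → a ≢ k → pos a k + pos k a ≡ n
  pos-+-pos {a} {k} a≢k = subst (λ z → pos a k + pos k a ≡ z + n) (pos-refl a)
    (pos-+-> a k a (subst (_< pos a k) (sym (pos-refl a)) (n≢0⇒n>0 (a≢k ∘ pos≡0⇒≡))))

  pos-injective : ∀ (a : Fin n) {x y} → pos a x ≡ pos a y → x ≡ y
  pos-injective a {x} {y} e = pos≡0⇒≡ (+-cancelˡ-≡ (pos a x) _ _
    (trans (pos-+-≤ a x y (≤-reflexive e)) (trans (sym e) (sym (+-identityʳ _)))))

  pos-surjective : ∀ (a : Fin n) {d} → d < n → ∃ λ k → pos a k ≡ d
  pos-surjective a {d} d<n with toℕ a + d <? n
  ... | yes a+d<n = fromℕ< a+d<n , cyclicDistance-unique (pos-isCyclicDistance a _) (d<n , 0 , inj₁ refl ,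
          trans (+-comm d (toℕ a)) (trans (sym (toℕ-fromℕ< a+d<n)) (sym (+-identityʳ _))))
  ... | no a+d≮n = fromℕ< a+d∸n<n , cyclicDistance-unique (pos-isCyclicDistance a _) (d<n , n , inj₂ refl ,
          trans (+-comm d (toℕ a)) (trans (sym (m∸n+n≡m n≤a+d)) (cong (_+ n) (sym (toℕ-fromℕ< a+d∸n<n)))))
    where
    n≤a+d : n ≤ toℕ a + d
    n≤a+d = ≮⇒≥ a+d≮n
    a+d∸n<n : toℕ a + d ∸ n < n
    a+d∸n<n = +-cancelʳ-< n _ _ (subst (_< n + n) (sym (m∸n+n≡m n≤a+d)) (+-mono-< (toℕ<n a) d<n))

  pos-+-toℕ : ∀ (a k : Fin n) → pos a k + toℕ a ≡ toℕ k + n * 𝟙 (toℕ k <ᵇ toℕ a)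
  pos-+-toℕ a k with toℕ k <ᵇ toℕ a in eq | pos-isCyclicDistance a k
  ... | true  | _ , _ , inj₂ refl , e = trans e (cong (toℕ k +_) (sym (*-identityʳ n)))
  ... | false | _ , _ , inj₁ refl , e = trans e (cong (toℕ k +_) (sym (*-zeroʳ n)))
  ... | true  | _ , _ , inj₁ refl , e = ⊥-elim (<⇒≱ (<ᵇ⇒< (toℕ k) (toℕ a) (subst T (sym eq) tt))
          (subst (toℕ a ≤_) (trans e (+-identityʳ _)) (m≤n+m (toℕ a) (pos a k))))
  ... | false | d<n , _ , inj₂ refl , e = ⊥-elim (subst T eq (<⇒<ᵇ (+-cancelʳ-< n (toℕ k) (toℕ a)
          (subst (_< toℕ a + n) e (subst (pos a k + toℕ a <_) (+-comm n (toℕ a)) (+-monoˡ-< (toℕ a) d<n))))))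

  _∈⟨_,_]? : ∀ (k a b : Fin n) → Dec (k ∈⟨ a , b ])
  k ∈⟨ a , b ]? = (0 <? pos a k) ×-dec (pos a k ≤? pos a b)

  ∈⟨⟩-right : ∀ {a b : Fin n} → a ≢ b → b ∈⟨ a , b ]
  ∈⟨⟩-right a≢b = n≢0⇒n>0 (a≢b ∘ pos≡0⇒≡) , ≤-refl

  ∉⟨a,a] : ∀ (a k : Fin n) → ¬ k ∈⟨ a , a ]
  ∉⟨a,a] a k (0<ak , ak≤aa) = <⇒≱ 0<ak (subst (pos a k ≤_) (pos-refl a) ak≤aa)

  pos-<⇒∈⟨⟩ : ∀ {i j k : Fin n} → i ≢ j → pos i j < pos i k → k ∈⟨ j , i ]
  pos-<⇒∈⟨⟩ {i} {j} {k} i≢j ij<ik = 0<jk , <⇒≤ jk<ji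
    where
    ij+jk≡ik : pos i j + pos j k ≡ pos i k
    ij+jk≡ik = pos-+-≤ i j k (<⇒≤ ij<ik)
    0<jk : 0 < pos j k
    0<jk = +-cancelˡ-< (pos i j) 0 _
      (subst (_< pos i j + pos j k) (sym (+-identityʳ _)) (subst (pos i j <_) (sym ij+jk≡ik) ij<ik))
    jk<ji : pos j k < pos j i
    jk<ji = +-cancelˡ-< (pos i j) _ _
      (subst₂ _<_ (sym ij+jk≡ik) (sym (pos-+-pos i≢j)) (pos<n i k))

  pos-≤⇒pos-< : ∀ {k c j : Fin n} → k ≢ c → pos k c ≤ pos k j → pos c j < pos c k
  pos-≤⇒pos-< {k} {c} {j} k≢c kc≤kj = +-cancelˡ-< (pos k c) _ _
    (subst₂ _<_ (sym (pos-+-≤ k c j kc≤kj)) (sym (pos-+-pos k≢c)) (pos<n k j))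

  pos-≤⇒∈⟨⟩ : ∀ {j c k : Fin n} → j ≢ c → pos k c ≤ pos k j → k ∈⟨ j , c ]
  pos-≤⇒∈⟨⟩ {j} {c} {k} j≢c kc≤kj with k ≟ c
  ... | yes refl = ∈⟨⟩-right j≢c
  ... | no k≢c   = pos-<⇒∈⟨⟩ (j≢c ∘ sym) (pos-≤⇒pos-< k≢c kc≤kj)

  ∈⟨⟩⇒pos-< : ∀ {j c x : Fin n} → x ∈⟨ j , c ] → x ≢ c → pos c j < pos c x
  ∈⟨⟩⇒pos-< {j} {c} {x} x∈@(0<jx , jx≤jc) x≢c = +-cancelˡ-< (pos j c) _ _
    (subst₂ _<_ (sym (pos-+-pos j≢c)) (sym (pos-+-> j c x jx<jc)) (+-monoˡ-< n 0<jx))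
    where
    j≢c : j ≢ c
    j≢c refl = ∉⟨a,a] j x x∈
    jx<jc : pos j x < pos j c
    jx<jc = ≤∧≢⇒< jx≤jc (x≢c ∘ pos-injective j)

  ∈⟨⟩-between : ∀ (a b k x : Fin n) → k ∈⟨ a , b ] → pos k x ≤ pos k b → x ∈⟨ a , b ]
  ∈⟨⟩-between a b k x (0<ak , ak≤ab) kx≤kb = from-triangle (pos-triangle a k x)
    where
    ak+kx≤ab : pos a k + pos k x ≤ pos a b
    ak+kx≤ab = subst (pos a k + pos k x ≤_) (pos-+-≤ a k b ak≤ab) (+-monoʳ-≤ (pos a k) kx≤kb)
    from-triangle : pos a k + pos k x ≡ pos a x ⊎ pos a k + pos k x ≡ pos a x + n → x ∈⟨ a , b ]
    from-triangle (inj₁ ak+kx≡ax) =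
      subst (0 <_) ak+kx≡ax (≤-trans 0<ak (m≤m+n _ _)) , subst (_≤ pos a b) ak+kx≡ax ak+kx≤ab
    from-triangle (inj₂ ak+kx≡ax+n) =
      ⊥-elim (m+n≮n (pos a x) n (subst (_< n) ak+kx≡ax+n (≤-<-trans ak+kx≤ab (pos<n a b))))

  sum-χ-pos-range : ∀ (a : Fin n) {m} → m < n → sum (λ k → χ ((0 <? pos a k) ×-dec (pos a k ≤? m))) ≡ m
  sum-χ-pos-range a {zero} _ =
    trans (sum-cong-≗ (λ k → χ-no ((0 <? pos a k) ×-dec (pos a k ≤? 0)) (λ (0<d , d≤0) → <⇒≱ 0<d d≤0)))
          (sum-replicate-zero n)
  sum-χ-pos-range a {suc m} 1+m<n = begin
    sum (λ k → χ ((0 <? pos a k) ×-dec (pos a k ≤? suc m)))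
      ≡⟨ sum-cong-≗ (λ k → χ-range-suc (pos a k) m) ⟩
    sum (λ k → χ ((0 <? pos a k) ×-dec (pos a k ≤? m)) + χ (pos a k ℕ.≟ suc m))
      ≡⟨ ∑-distrib-+ (λ k → χ ((0 <? pos a k) ×-dec (pos a k ≤? m))) (λ k → χ (pos a k ℕ.≟ suc m)) ⟩
    sum (λ k → χ ((0 <? pos a k) ×-dec (pos a k ≤? m))) + sum (λ k → χ (pos a k ℕ.≟ suc m))
      ≡⟨ cong₂ _+_ (sum-χ-pos-range a (<-trans (n<1+n m) 1+m<n)) exactly-one ⟩
    m + 1
      ≡⟨ +-comm m 1 ⟩
    suc m ∎
    where
    open ≡-Reasoning
    exactly-one : sum (λ k → χ (pos a k ℕ.≟ suc m)) ≡ 1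
    exactly-one with pos-surjective a 1+m<n
    ... | k , ak≡1+m = sum-χ-unique (λ k → pos a k ℕ.≟ suc m) ak≡1+m
                         (λ i ai≡1+m → pos-injective a (trans ai≡1+m (sym ak≡1+m)))

  sum-χ-∈⟨⟩ : ∀ (a b : Fin n) → sum (λ k → χ (k ∈⟨ a , b ]?)) ≡ pos a b
  sum-χ-∈⟨⟩ a b = sum-χ-pos-range a (pos<n a b)

_≟ᶜ_ : (x y : Col) → Dec (x ≡ y)
c0  ≟ᶜ c0  = yes refl
c0  ≟ᶜ c+1 = no λ ()
c0  ≟ᶜ c-1 = no λ ()
c+1 ≟ᶜ c0  = no λ ()
c+1 ≟ᶜ c+1 = yes refl
c+1 ≟ᶜ c-1 = no λ ()
c-1 ≟ᶜ c0  = no λ ()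
c-1 ≟ᶜ c+1 = no λ ()
c-1 ≟ᶜ c-1 = yes refl

module DecPermProperties {n : ℕ} (π : DecPerm n) where

  ⁻¹-inverseˡ : ∀ i → π ⁻¹$ₚ (π $ₚ i) ≡ i
  ⁻¹-inverseˡ i = inverseˡ (perm π)

  ⁻¹-inverseʳ : ∀ v → π $ₚ (π ⁻¹$ₚ v) ≡ v
  ⁻¹-inverseʳ v = inverseʳ (perm π)

  $ₚ⇒⁻¹$ₚ : ∀ {i v} → π $ₚ i ≡ v → π ⁻¹$ₚ v ≡ i
  $ₚ⇒⁻¹$ₚ {i} refl = ⁻¹-inverseˡ i

  $ₚ-injective : ∀ {i j} → π $ₚ i ≡ π $ₚ j → i ≡ j
  $ₚ-injective {i} e = trans (sym (⁻¹-inverseˡ i)) ($ₚ⇒⁻¹$ₚ (sym e))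

  col≡c0⇒unfixed : ∀ {v} → col π v ≡ c0 → π $ₚ v ≢ v
  col≡c0⇒unfixed = Equivalence.to (col-ok π _)

  unfixed⇒col≡c0 : ∀ {v} → π $ₚ v ≢ v → col π v ≡ c0
  unfixed⇒col≡c0 = Equivalence.from (col-ok π _)

  col≢c0⇒fixed : ∀ {v} → col π v ≢ c0 → π $ₚ v ≡ v
  col≢c0⇒fixed {v} col≢c0 with π $ₚ v ≟ v
  ... | yes fixed = fixed
  ... | no unfixed = ⊥-elim (col≢c0 (unfixed⇒col≡c0 unfixed))

  loop⇒fixed : ∀ {v} → isLoop π v → π $ₚ v ≡ v
  loop⇒fixed loop = col≢c0⇒fixed (λ col≡c0 → case trans (sym loop) col≡c0 of λ ())

  coloop⇒fixed : ∀ {v} → isColoop π v → π $ₚ v ≡ v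
  coloop⇒fixed coloop = col≢c0⇒fixed (λ col≡c0 → case trans (sym coloop) col≡c0 of λ ())

  fixed⇒col≢c0 : ∀ {v} → π $ₚ v ≡ v → col π v ≢ c0
  fixed⇒col≢c0 fixed col≡c0 = col≡c0⇒unfixed col≡c0 fixed

  fixed⇒loop⊎coloop : ∀ {v} → π $ₚ v ≡ v → isLoop π v ⊎ isColoop π v
  fixed⇒loop⊎coloop {v} fixed with col π v in eq
  ... | c0  = ⊥-elim (col≡c0⇒unfixed eq fixed)
  ... | c+1 = inj₁ refl
  ... | c-1 = inj₂ refl

_≋_ : ∀ {n} → DecPerm n → DecPerm n → Set
σ ≋ π = (∀ i → σ $ₚ i ≡ π $ₚ i) × (∀ i → col σ i ≡ col π i)

inRankSet : ∀ {n} → DecPerm n → Fin n → Bool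
inRankSet π j = (toℕ j <ᵇ toℕ (π ⁻¹$ₚ j)) ∨ isColoopᵇ (col π j)

rk-cong : ∀ {n} (σ π : DecPerm n) → σ ≋ π → rk σ ≡ rk π
rk-cong {n} σ π (same-perm , same-col) =
  trans (count≡sum (inRankSet σ)) (trans (sum-cong-≗ same-indicator) (sym (count≡sum (inRankSet π))))
  where
  module S = DecPermProperties σ
  module P = DecPermProperties π
  same-inverse : ∀ v → σ ⁻¹$ₚ v ≡ π ⁻¹$ₚ v
  same-inverse v = sym (P.$ₚ⇒⁻¹$ₚ (trans (sym (same-perm _)) (S.⁻¹-inverseʳ v)))
  same-indicator : ∀ v → 𝟙 (inRankSet σ v) ≡ 𝟙 (inRankSet π v)
  same-indicator v rewrite same-inverse v | same-col v = refl

coloopBonus : ℕ → Col → ℕ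
coloopBonus n c = if isColoopᵇ c then n else 0

coloopBonus-injective : ∀ {n} → 0 < n → ∀ {x y} → x ≢ c0 → y ≢ c0 → coloopBonus n x ≡ coloopBonus n y → x ≡ y
coloopBonus-injective _   {c0}        x≢c0 _    _ = ⊥-elim (x≢c0 refl)
coloopBonus-injective _   {_}   {c0} _    y≢c0 _ = ⊥-elim (y≢c0 refl)
coloopBonus-injective _   {c+1} {c+1} _ _ _ = refl
coloopBonus-injective _   {c-1} {c-1} _ _ _ = refl
coloopBonus-injective n>0 {c+1} {c-1} _ _ 0≡n = ⊥-elim (<⇒≢ n>0 0≡n)
coloopBonus-injective n>0 {c-1} {c+1} _ _ n≡0 = ⊥-elim (<⇒≢ n>0 (sym n≡0))

-- An element counted by rk π is one whose cyclic step π⁻¹ v → v wraps past n, or a coloop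
-- (a full turn); so summing the step lengths, with a full turn for each coloop, gives n · rk π.
weight : ∀ {n} → DecPerm n → Fin n → ℕ
weight {n} π v = pos (π ⁻¹$ₚ v) v + coloopBonus n (col π v)

weight-+-toℕ : ∀ {n} (π : DecPerm n) v → weight π v + toℕ (π ⁻¹$ₚ v) ≡ toℕ v + n * 𝟙 (inRankSet π v)
weight-+-toℕ {n} π v with col π v in eq
... | c-1 rewrite DecPermProperties.$ₚ⇒⁻¹$ₚ π (DecPermProperties.coloop⇒fixed π eq) | pos-refl v
                | ∨-zeroʳ (toℕ v <ᵇ toℕ v) = trans (+-comm n (toℕ v)) (cong (toℕ v +_) (sym (*-identityʳ n)))
... | c0  rewrite ∨-identityʳ (toℕ v <ᵇ toℕ (π ⁻¹$ₚ v)) | +-identityʳ (pos (π ⁻¹$ₚ v) v) = pos-+-toℕ (π ⁻¹$ₚ v) v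
... | c+1 rewrite ∨-identityʳ (toℕ v <ᵇ toℕ (π ⁻¹$ₚ v)) | +-identityʳ (pos (π ⁻¹$ₚ v) v) = pos-+-toℕ (π ⁻¹$ₚ v) v

weight-coloop : ∀ {n} (π : DecPerm n) {v} → isColoop π v → weight π v ≡ n
weight-coloop π {v} coloop
  rewrite DecPermProperties.$ₚ⇒⁻¹$ₚ π (DecPermProperties.coloop⇒fixed π coloop) | pos-refl v | coloop = refl

weight-non-coloop : ∀ {n} (π : DecPerm n) {v} → ¬ isColoop π v → weight π v ≡ pos (π ⁻¹$ₚ v) v
weight-non-coloop π {v} ¬coloop with col π v
... | c0  = +-identityʳ _
... | c+1 = +-identityʳ _
... | c-1 = ⊥-elim (¬coloop refl)

sum-weight : ∀ {n} (π : DecPerm n) → sum (weight π) ≡ n * rk π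
sum-weight {n} π = +-cancelʳ-≡ (sum (toℕ ∘ (π ⁻¹$ₚ_))) _ _ (begin
  sum (weight π) + sum (toℕ ∘ (π ⁻¹$ₚ_))            ≡⟨ ∑-distrib-+ (weight π) (toℕ ∘ (π ⁻¹$ₚ_)) ⟨
  sum (λ v → weight π v + toℕ (π ⁻¹$ₚ v))          ≡⟨ sum-cong-≗ (weight-+-toℕ π) ⟩
  sum (λ v → toℕ v + n * 𝟙 (inRankSet π v))        ≡⟨ ∑-distrib-+ (toℕ {n}) (λ v → n * 𝟙 (inRankSet π v)) ⟩
  sum (toℕ {n}) + sum (λ v → n * 𝟙 (inRankSet π v)) ≡⟨ cong₂ _+_ (∑-permute (toℕ {n}) (flip (perm π))) (sym (*-distribˡ-sum n (𝟙 ∘ inRankSet π))) ⟩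
  sum (toℕ ∘ (π ⁻¹$ₚ_)) + n * sum (𝟙 ∘ inRankSet π) ≡⟨ cong (λ r → sum (toℕ ∘ (π ⁻¹$ₚ_)) + n * r) (count≡sum (inRankSet π)) ⟨
  sum (toℕ ∘ (π ⁻¹$ₚ_)) + n * rk π                 ≡⟨ +-comm _ (n * rk π) ⟩
  n * rk π + sum (toℕ ∘ (π ⁻¹$ₚ_))                 ∎)
  where open ≡-Reasoning

subset : ∀ {n p} {P : Fin n → Set p} → Decidable P → Subset n
subset P? = Vec.tabulate (does ∘ P?)

∈-subset⁺ : ∀ {n p} {P : Fin n → Set p} (P? : Decidable P) {i} → P i → i ∈ subset P?
∈-subset⁺ P? {i} p = lookup⇒[]= i (subset P?) (trans (lookup∘tabulate (does ∘ P?) i) (dec-true (P? i) p))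

∈-subset⁻ : ∀ {n p} {P : Fin n → Set p} (P? : Decidable P) {i} → i ∈ subset P? → P i
∈-subset⁻ P? {i} i∈ = witness (P? i) (trans (sym (lookup∘tabulate (does ∘ P?) i)) ([]=⇒lookup i∈))
  where
  witness : ∀ {p} {P : Set p} (P? : Dec P) → does P? ≡ true → P
  witness (yes p) _ = p

module ShiftIntervals {n : ℕ} (π σ : DecPerm n) where

  private
    module P = DecPermProperties π
    module S = DecPermProperties σ

  Special : Fin n → Set
  Special v = isLoop σ v × isColoop π v

  special? : Decidable Special
  special? v = (col σ v ≟ᶜ c+1) ×-dec (col π v ≟ᶜ c-1)

  special⇒π-fixed : ∀ {v} → Special v → π $ₚ v ≡ v
  special⇒π-fixed = P.coloop⇒fixed ∘ proj₂

  special⇒σ-fixed : ∀ {v} → Special v → σ $ₚ v ≡ v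
  special⇒σ-fixed = S.loop⇒fixed ∘ proj₁

  _∈S?_ : ∀ k v → Dec (k ∈S[ π , σ ] v)
  k ∈S? v = special? v ⊎-dec (¬? (special? v) ×-dec k ∈⟨ π ⁻¹$ₚ v , σ ⁻¹$ₚ v ]?)

  ∈S-regular : ∀ {k v} → ¬ Special v → k ∈S[ π , σ ] v → k ∈⟨ π ⁻¹$ₚ v , σ ⁻¹$ₚ v ]
  ∈S-regular ¬s (inj₁ s)       = ⊥-elim (¬s s)
  ∈S-regular ¬s (inj₂ (_ , p)) = p

  length : Fin n → ℕ
  length v = if does (special? v) then n else pos (π ⁻¹$ₚ v) (σ ⁻¹$ₚ v)

  length-special : ∀ {v} → Special v → length v ≡ n
  length-special {v} s = cong (if_then n else pos (π ⁻¹$ₚ v) (σ ⁻¹$ₚ v)) (dec-true (special? v) s)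

  length-regular : ∀ {v} → ¬ Special v → length v ≡ pos (π ⁻¹$ₚ v) (σ ⁻¹$ₚ v)
  length-regular {v} ¬s = cong (if_then n else pos (π ⁻¹$ₚ v) (σ ⁻¹$ₚ v)) (dec-false (special? v) ¬s)

  sum-χ-∈S : ∀ v → sum (λ k → χ (k ∈S? v)) ≡ length v
  sum-χ-∈S v = case special? v of λ where
    (yes s) → trans (sum-cong-≗ (λ k → χ-yes (k ∈S? v) (inj₁ s))) (trans (sum-ones n) (sym (length-special s)))
    (no ¬s) → trans (sum-cong-≗ (λ k → χ-cong (k ∈S? v) (k ∈⟨ π ⁻¹$ₚ v , σ ⁻¹$ₚ v ]?) (∈S-regular ¬s) (λ p → inj₂ (¬s , p))))
                    (trans (sum-χ-∈⟨⟩ (π ⁻¹$ₚ v) (σ ⁻¹$ₚ v)) (sym (length-regular ¬s)))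

  sum-length : ShiftIntervalsPartition π σ → sum length ≡ n
  sum-length (disjoint , covering) = begin
    sum length                                ≡⟨ sum-cong-≗ (sym ∘ sum-χ-∈S) ⟩
    sum (λ v → sum (λ k → χ (k ∈S? v)))       ≡⟨ ∑-comm (λ v k → χ (k ∈S? v)) ⟩
    sum (λ k → sum (λ v → χ (k ∈S? v)))       ≡⟨ sum-cong-≗ exactly-one ⟩
    sum {n} (λ _ → 1)                         ≡⟨ sum-ones n ⟩
    n                                         ∎
    where
    open ≡-Reasoning
    exactly-one : ∀ k → sum (λ v → χ (k ∈S? v)) ≡ 1
    exactly-one k with covering k
    ... | v , k∈Sv = sum-χ-unique (k ∈S?_) k∈Sv (λ w k∈Sw → disjoint w v k k∈Sw k∈Sv)

  weight-≤-regular : ∀ {v} → ¬ Special v → weight π v ≤ pos (π ⁻¹$ₚ v) (σ ⁻¹$ₚ v) + weight σ v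
  weight-≤-regular {v} ¬s = case col π v ≟ᶜ c-1 of λ where
      (no ¬coloop) → begin
        weight π v              ≡⟨ weight-non-coloop π ¬coloop ⟩
        pos a v                 ≤⟨ pos-≤-+ a b v ⟩
        pos a b + pos b v       ≤⟨ +-monoʳ-≤ (pos a b) (m≤m+n _ _) ⟩
        pos a b + weight σ v    ∎
      (yes coloop) → subst (λ a → weight π v ≤ pos a b + weight σ v) (sym (P.$ₚ⇒⁻¹$ₚ (P.coloop⇒fixed coloop)))
                       (subst (_≤ pos v b + weight σ v) (sym (weight-coloop π coloop)) (coloop-case coloop))
    where
    open ≤-Reasoning
    a = π ⁻¹$ₚ v
    b = σ ⁻¹$ₚ v
    coloop-case : isColoop π v → n ≤ pos v b + weight σ v
    coloop-case coloop with b ≟ v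
    ... | no b≢v = begin
      n                       ≡⟨ pos-+-pos (b≢v ∘ sym) ⟨
      pos v b + pos b v       ≤⟨ +-monoʳ-≤ (pos v b) (m≤m+n _ _) ⟩
      pos v b + weight σ v    ∎
    ... | yes b≡v with S.fixed⇒loop⊎coloop (trans (cong (σ $ₚ_) (sym b≡v)) (S.⁻¹-inverseʳ v))
    ...   | inj₁ loop = ⊥-elim (¬s (loop , coloop))
    ...   | inj₂ σ-coloop = subst (n ≤_) (cong (pos v b +_) (sym (weight-coloop σ σ-coloop))) (m≤n+m n _)

  weight-≤ : ∀ v → weight π v ≤ length v + weight σ v
  weight-≤ v = case special? v of λ where
    (yes s) → subst₂ (λ l w → w ≤ l + weight σ v) (sym (length-special s)) (sym (weight-coloop π (proj₂ s)))
                     (m≤m+n n _)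
    (no ¬s) → subst (λ l → weight π v ≤ l + weight σ v) (sym (length-regular ¬s)) (weight-≤-regular ¬s)

module PartitionToCyclicShift {n : ℕ} (σ π : DecPerm n) (rank : suc (rk σ) ≡ rk π)
                              (partition : ShiftIntervalsPartition π σ) where

  open ShiftIntervals π σ
  private
    module P = DecPermProperties π
    module S = DecPermProperties σ

  weight-≡ : ∀ v → weight π v ≡ length v + weight σ v
  weight-≡ = sum-mono-≤-≡⇒≗ weight-≤ (begin
    sum (weight π)                          ≡⟨ sum-weight π ⟩
    n * rk π                                ≡⟨ cong (n *_) rank ⟨
    n * suc (rk σ)                          ≡⟨ *-suc n (rk σ) ⟩
    n + n * rk σ                            ≡⟨ cong₂ _+_ (sum-length partition) (sum-weight σ) ⟨
    sum length + sum (weight σ)             ≡⟨ ∑-distrib-+ length (weight σ) ⟨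
    sum (λ v → length v + weight σ v)       ∎)
    where open ≡-Reasoning

  σ-fixed⇒coloopBonus-≡ : ∀ {v} → ¬ Special v → σ $ₚ v ≡ v → coloopBonus n (col π v) ≡ coloopBonus n (col σ v)
  σ-fixed⇒coloopBonus-≡ {v} ¬s fixed = +-cancelˡ-≡ (pos a v) _ _ (begin
    pos a v + coloopBonus n (col π v)       ≡⟨ weight-≡ v ⟩
    length v + weight σ v                   ≡⟨ cong₂ _+_ (trans (length-regular ¬s) (cong (pos a) σ⁻¹v≡v)) σ-weight ⟩
    pos a v + coloopBonus n (col σ v)       ∎)
    where
    open ≡-Reasoning
    a = π ⁻¹$ₚ v
    σ⁻¹v≡v : σ ⁻¹$ₚ v ≡ v
    σ⁻¹v≡v = S.$ₚ⇒⁻¹$ₚ fixed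
    σ-weight : weight σ v ≡ coloopBonus n (col σ v)
    σ-weight = cong (_+ coloopBonus n (col σ v)) (trans (cong (λ b → pos b v) σ⁻¹v≡v) (pos-refl v))

  n>0 : Fin n → 0 < n
  n>0 i = ≤-<-trans z≤n (toℕ<n i)

  fixed⇒same-col : ∀ {v} → ¬ Special v → π $ₚ v ≡ v → σ $ₚ v ≡ v → col σ v ≡ col π v
  fixed⇒same-col {v} ¬s π-fixed σ-fixed = sym (coloopBonus-injective (n>0 v)
    (P.fixed⇒col≢c0 π-fixed) (S.fixed⇒col≢c0 σ-fixed) (σ-fixed⇒coloopBonus-≡ ¬s σ-fixed))

  σ-fixed⇒loop : ∀ {v} → ¬ Special v → π $ₚ v ≢ v → σ $ₚ v ≡ v → isLoop σ v
  σ-fixed⇒loop {v} ¬s π-unfixed σ-fixed with S.fixed⇒loop⊎coloop σ-fixed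
  ... | inj₁ loop   = loop
  ... | inj₂ coloop = ⊥-elim (<⇒≢ (n>0 v) (begin
    0                                       ≡⟨ cong (coloopBonus n) (P.unfixed⇒col≡c0 π-unfixed) ⟨
    coloopBonus n (col π v)                 ≡⟨ σ-fixed⇒coloopBonus-≡ ¬s σ-fixed ⟩
    coloopBonus n (col σ v)                 ≡⟨ cong (coloopBonus n) coloop ⟩
    n                                       ∎))
    where open ≡-Reasoning

  Kept : Fin n → Set
  Kept i = π $ₚ i ≡ σ $ₚ i × ¬ Special (σ $ₚ i)

  kept? : Decidable Kept
  kept? i = (π $ₚ i ≟ σ $ₚ i) ×-dec ¬? (special? (σ $ₚ i))

  A : Subset n
  A = subset kept?

  ∉A⇒∈S-σ : ∀ {k} → k ∉ A → k ∈S[ π , σ ] (σ $ₚ k)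
  ∉A⇒∈S-σ {k} k∉A with special? (σ $ₚ k)
  ... | yes s  = inj₁ s
  ... | no ¬s = inj₂ (¬s , subst (λ b → k ∈⟨ π ⁻¹$ₚ (σ $ₚ k) , b ]) (sym (S.⁻¹-inverseˡ k)) (∈⟨⟩-right moved))
    where
    moved : π ⁻¹$ₚ (σ $ₚ k) ≢ k
    moved e = k∉A (∈-subset⁺ kept? (trans (cong (π $ₚ_) (sym e)) (P.⁻¹-inverseʳ (σ $ₚ k)) , ¬s))

  ∉A∧∈S-σ⇒≡ : ∀ {i k} → k ∉ A → k ∈S[ π , σ ] (σ $ₚ i) → k ≡ i
  ∉A∧∈S-σ⇒≡ {i} {k} k∉A k∈S = S.$ₚ-injective (proj₁ partition (σ $ₚ k) (σ $ₚ i) k (∉A⇒∈S-σ k∉A) k∈S)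

  shift-∈A : ∀ {i} → i ∈ A → σ $ₚ i ≡ π $ₚ i × col σ i ≡ col π i
  shift-∈A {i} i∈A with ∈-subset⁻ kept? i∈A | σ $ₚ i ≟ i
  ... | π≡σ , ¬s | yes fixed = sym π≡σ , fixed⇒same-col (subst (¬_ ∘ Special) fixed ¬s) (trans π≡σ fixed) fixed
  ... | π≡σ , ¬s | no unfixed = sym π≡σ , trans (S.unfixed⇒col≡c0 unfixed) (sym (P.unfixed⇒col≡c0 (unfixed ∘ trans (sym π≡σ))))

  shift-colour : ∀ {i} → i ∉ A → col σ i ≡ (if does (σ $ₚ i ≟ i) then c+1 else c0)
  shift-colour {i} i∉A with σ $ₚ i ≟ i
  ... | no unfixed = S.unfixed⇒col≡c0 unfixed
  ... | yes fixed with special? i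
  ...   | yes s = proj₁ s
  ...   | no ¬s = σ-fixed⇒loop ¬s (λ π-fixed → i∉A (∈-subset⁺ kept? (trans π-fixed (sym fixed) , subst (¬_ ∘ Special) (sym fixed) ¬s))) fixed

  shift-∉A-special : ∀ {i} → i ∉ A → Special (σ $ₚ i) →
    (∀ k → k ∉ A → k ≤[ i ] i) × σ $ₚ i ≡ π $ₚ i
  shift-∉A-special {i} i∉A s = (λ k k∉A → ≤-reflexive (cong (pos i) (∉A∧∈S-σ⇒≡ k∉A (inj₁ s)))) ,
    trans σi≡i (sym (trans (cong (π $ₚ_) (sym σi≡i)) (trans (special⇒π-fixed s) σi≡i)))
    where
    σi≡i : σ $ₚ i ≡ i
    σi≡i = S.$ₚ-injective (special⇒σ-fixed s)

  shift-∉A-regular : ∀ {i} → i ∉ A → ¬ Special (σ $ₚ i) →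
    π ⁻¹$ₚ (σ $ₚ i) ∉ A × (∀ k → k ∉ A → k ≤[ i ] (π ⁻¹$ₚ (σ $ₚ i)))
  shift-∉A-regular {i} i∉A ¬s = j∉A , j-max
    where
    j = π ⁻¹$ₚ (σ $ₚ i)
    i≢j : i ≢ j
    i≢j i≡j = i∉A (∈-subset⁺ kept? (trans (cong (π $ₚ_) i≡j) (P.⁻¹-inverseʳ (σ $ₚ i)) , ¬s))
    j∉A : j ∉ A
    j∉A j∈A = i≢j (sym (S.$ₚ-injective (trans (sym (proj₁ (∈-subset⁻ kept? j∈A))) (P.⁻¹-inverseʳ (σ $ₚ i)))))
    j-max : ∀ k → k ∉ A → k ≤[ i ] j
    j-max k k∉A with pos i k ≤? pos i j
    ... | yes ik≤ij = ik≤ij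
    ... | no ik≰ij = ⊥-elim (<⇒≱ (≤-<-trans z≤n ij<ik) (≤-reflexive (trans (cong (pos i) k≡i) (pos-refl i))))
      where
      ij<ik : pos i j < pos i k
      ij<ik = ≰⇒> ik≰ij
      k∈S : k ∈S[ π , σ ] (σ $ₚ i)
      k∈S = inj₂ (¬s , subst (λ b → k ∈⟨ j , b ]) (sym (S.⁻¹-inverseˡ i)) (pos-<⇒∈⟨⟩ i≢j ij<ik))
      k≡i : k ≡ i
      k≡i = ∉A∧∈S-σ⇒≡ k∉A k∈S

  shift : IsCyclicShift A π σ
  shift i = shift-∈A , λ i∉A → case special? (σ $ₚ i) of λ where
    (yes s) → let k≤i , σi≡πi = shift-∉A-special i∉A s in
              i , i∉A , k≤i , σi≡πi , shift-colour i∉A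
    (no ¬s) → let j∉A , k≤j = shift-∉A-regular i∉A ¬s in
              π ⁻¹$ₚ (σ $ₚ i) , j∉A , k≤j , sym (P.⁻¹-inverseʳ (σ $ₚ i)) , shift-colour i∉A

module CyclicShiftToPartition {n : ℕ} (σ π : DecPerm n) (σ≉π : ¬ σ ≋ π)
                              (A : Subset n) (shift : IsCyclicShift A π σ) where

  open ShiftIntervals π σ
  private
    module P = DecPermProperties π
    module S = DecPermProperties σ

  ∈A⇒same-perm : ∀ {i} → i ∈ A → σ $ₚ i ≡ π $ₚ i
  ∈A⇒same-perm {i} = proj₁ ∘ proj₁ (shift i)

  ∈A⇒same-col : ∀ {i} → i ∈ A → col σ i ≡ col π i
  ∈A⇒same-col {i} = proj₂ ∘ proj₁ (shift i)

  -- The last element of ∁A before i in cyclic order (i itself when ∁A = {i}).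
  prev : ∀ i → i ∉ A → Fin n
  prev i i∉A = proj₁ (proj₂ (shift i) i∉A)

  prev-∉A : ∀ {i} (i∉A : i ∉ A) → prev i i∉A ∉ A
  prev-∉A {i} i∉A with proj₂ (shift i) i∉A
  ... | _ , j∉A , _ = j∉A

  prev-max : ∀ {i} (i∉A : i ∉ A) k → k ∉ A → pos i k ≤ pos i (prev i i∉A)
  prev-max {i} i∉A with proj₂ (shift i) i∉A
  ... | _ , _ , j-max , _ = j-max

  σ≡π∘prev : ∀ {i} (i∉A : i ∉ A) → σ $ₚ i ≡ π $ₚ prev i i∉A
  σ≡π∘prev {i} i∉A with proj₂ (shift i) i∉A
  ... | _ , _ , _ , σi≡πj , _ = σi≡πj

  ∉A-col : ∀ {i} → i ∉ A → col σ i ≡ (if does (σ $ₚ i ≟ i) then c+1 else c0)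
  ∉A-col {i} i∉A with proj₂ (shift i) i∉A
  ... | _ , _ , _ , _ , colour = colour

  ∁A-nonempty : ∃ λ c → c ∉ A
  ∁A-nonempty with all? (_∈? A)
  ... | yes all∈A = ⊥-elim (σ≉π (∈A⇒same-perm ∘ all∈A , ∈A⇒same-col ∘ all∈A))
  ... | no ¬all∈A = ¬∀⟶∃¬ n (_∈ A) (_∈? A) ¬all∈A

  prev-self⇒∁A≡⁅c⁆ : ∀ {c} (c∉A : c ∉ A) → prev c c∉A ≡ c → ∀ {x} → x ∉ A → x ≡ c
  prev-self⇒∁A≡⁅c⁆ {c} c∉A prev≡c {x} x∉A = sym (pos≡0⇒≡ (n≤0⇒n≡0
    (subst (pos c x ≤_) (trans (cong (pos c) prev≡c) (pos-refl c)) (prev-max c∉A x x∉A))))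

  prev-self⇒coloop : ∀ {c} (c∉A : c ∉ A) → prev c c∉A ≡ c → isColoop π c
  prev-self⇒coloop {c} c∉A prev≡c = case π $ₚ c ≟ c of λ where
      (no unfixed) → ⊥-elim (σ≉π (same-perm , same-col (begin
        col σ c                                   ≡⟨ ∉A-col c∉A ⟩
        (if does (σ $ₚ c ≟ c) then c+1 else c0)   ≡⟨ cong (if_then c+1 else c0) (dec-false (σ $ₚ c ≟ c) (unfixed ∘ trans (sym σc≡πc))) ⟩
        c0                                        ≡⟨ P.unfixed⇒col≡c0 unfixed ⟨
        col π c                                   ∎)))
      (yes fixed) → case P.fixed⇒loop⊎coloop fixed of λ where
        (inj₂ coloop) → coloop
        (inj₁ loop) → ⊥-elim (σ≉π (same-perm , same-col (begin
          col σ c                                 ≡⟨ ∉A-col c∉A ⟩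
          (if does (σ $ₚ c ≟ c) then c+1 else c0) ≡⟨ cong (if_then c+1 else c0) (dec-true (σ $ₚ c ≟ c) (trans σc≡πc fixed)) ⟩
          c+1                                     ≡⟨ loop ⟨
          col π c                                 ∎)))
    where
    open ≡-Reasoning
    ∁A≡⁅c⁆ : ∀ {x} → x ≢ c → x ∈ A
    ∁A≡⁅c⁆ {x} x≢c with x ∈? A
    ... | yes x∈A = x∈A
    ... | no x∉A  = ⊥-elim (x≢c (prev-self⇒∁A≡⁅c⁆ c∉A prev≡c x∉A))
    σc≡πc : σ $ₚ c ≡ π $ₚ c
    σc≡πc = trans (σ≡π∘prev c∉A) (cong (π $ₚ_) prev≡c)
    same-perm : ∀ x → σ $ₚ x ≡ π $ₚ x
    same-perm x with x ≟ c
    ... | yes refl = σc≡πc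
    ... | no x≢c   = ∈A⇒same-perm (∁A≡⁅c⁆ x≢c)
    same-col : col σ c ≡ col π c → ∀ x → col σ x ≡ col π x
    same-col same-at-c x with x ≟ c
    ... | yes refl = same-at-c
    ... | no x≢c   = ∈A⇒same-col (∁A≡⁅c⁆ x≢c)

  special⇒∉A : ∀ {v} → Special v → v ∉ A
  special⇒∉A (loop , coloop) v∈A = case trans (sym loop) (trans (∈A⇒same-col v∈A) coloop) of λ ()

  special⇒∁A≡⁅v⁆ : ∀ {v} → Special v → ∀ {x} → x ∉ A → x ≡ v
  special⇒∁A≡⁅v⁆ {v} s = prev-self⇒∁A≡⁅c⁆ (special⇒∉A s)
    (P.$ₚ-injective (trans (sym (σ≡π∘prev (special⇒∉A s))) (trans (special⇒σ-fixed s) (sym (special⇒π-fixed s)))))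

  ∉A∧∈⟨prev⟩⇒≡ : ∀ {c x} (c∉A : c ∉ A) → x ∉ A → x ∈⟨ prev c c∉A , c ] → x ≡ c
  ∉A∧∈⟨prev⟩⇒≡ {c} {x} c∉A x∉A x∈ with x ≟ c
  ... | yes x≡c = x≡c
  ... | no x≢c  = ⊥-elim (<⇒≱ (∈⟨⟩⇒pos-< x∈ x≢c) (prev-max c∉A x x∉A))

  -- A regular shift interval S_v is (prev i, i] for the i ∉ A with σ i = v.
  RegularMember : Fin n → Fin n → Set
  RegularMember k v = Σ (Fin n) λ i → Σ (i ∉ A) λ i∉A → σ $ₚ i ≡ v × k ∈⟨ prev i i∉A , i ]

  ∈S⇒special⊎regular : ∀ {k v} → k ∈S[ π , σ ] v → Special v ⊎ RegularMember k v
  ∈S⇒special⊎regular (inj₁ s) = inj₁ s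
  ∈S⇒special⊎regular {k} {v} (inj₂ (¬s , k∈)) with σ ⁻¹$ₚ v ∈? A
  ... | yes i∈A = ⊥-elim (∉⟨a,a] (σ ⁻¹$ₚ v) k (subst (λ a → k ∈⟨ a , σ ⁻¹$ₚ v ]) π⁻¹v≡σ⁻¹v k∈))
    where
    π⁻¹v≡σ⁻¹v : π ⁻¹$ₚ v ≡ σ ⁻¹$ₚ v
    π⁻¹v≡σ⁻¹v = P.$ₚ⇒⁻¹$ₚ (trans (sym (∈A⇒same-perm i∈A)) (S.⁻¹-inverseʳ v))
  ... | no i∉A = inj₂ (σ ⁻¹$ₚ v , i∉A , S.⁻¹-inverseʳ v ,
                       subst (λ a → k ∈⟨ a , σ ⁻¹$ₚ v ]) (sym prev≡π⁻¹v) k∈)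
    where
    prev≡π⁻¹v : prev (σ ⁻¹$ₚ v) i∉A ≡ π ⁻¹$ₚ v
    prev≡π⁻¹v = sym (P.$ₚ⇒⁻¹$ₚ (trans (sym (σ≡π∘prev i∉A)) (S.⁻¹-inverseʳ v)))

  intervals-disjoint : ∀ {i i′ k} (i∉A : i ∉ A) (i′∉A : i′ ∉ A) →
    k ∈⟨ prev i i∉A , i ] → k ∈⟨ prev i′ i′∉A , i′ ] → i ≡ i′
  intervals-disjoint {i} {i′} {k} i∉A i′∉A k∈ k∈′ with ≤-total (pos k i) (pos k i′)
  ... | inj₁ ki≤ki′ = ∉A∧∈⟨prev⟩⇒≡ i′∉A i∉A (∈⟨⟩-between (prev i′ i′∉A) i′ k i k∈′ ki≤ki′)
  ... | inj₂ ki′≤ki = sym (∉A∧∈⟨prev⟩⇒≡ i∉A i′∉A (∈⟨⟩-between (prev i i∉A) i k i′ k∈ ki′≤ki))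

  disjoint : ∀ v w k → k ∈S[ π , σ ] v → k ∈S[ π , σ ] w → v ≡ w
  disjoint v w k k∈v k∈w with ∈S⇒special⊎regular k∈v | ∈S⇒special⊎regular k∈w
  ... | inj₁ s | inj₁ s′ = sym (special⇒∁A≡⁅v⁆ s (special⇒∉A s′))
  ... | inj₁ s | inj₂ (i , i∉A , σi≡w , _) =
    trans (sym (special⇒σ-fixed s)) (trans (cong (σ $ₚ_) (sym (special⇒∁A≡⁅v⁆ s i∉A))) σi≡w)
  ... | inj₂ (i , i∉A , σi≡v , _) | inj₁ s′ =
    trans (sym σi≡v) (trans (cong (σ $ₚ_) (special⇒∁A≡⁅v⁆ s′ i∉A)) (special⇒σ-fixed s′))
  ... | inj₂ (i , i∉A , σi≡v , k∈) | inj₂ (i′ , i′∉A , σi′≡w , k∈′) =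
    trans (sym σi≡v) (trans (cong (σ $ₚ_) (intervals-disjoint i∉A i′∉A k∈ k∈′)) σi′≡w)

  -- k lies in the interval ending at the first element of ∁A reached from k.
  cover : ∀ k → ∃ λ v → k ∈S[ π , σ ] v
  cover k with argmin (¬? ∘ (_∈? A)) (pos k) ∁A-nonempty
  ... | c , c∉A , c-min = σ $ₚ c , k∈S
    where
    π⁻¹σc≡prev : π ⁻¹$ₚ (σ $ₚ c) ≡ prev c c∉A
    π⁻¹σc≡prev = P.$ₚ⇒⁻¹$ₚ (sym (σ≡π∘prev c∉A))
    k∈ : ¬ Special (σ $ₚ c) → k ∈⟨ prev c c∉A , c ]
    k∈ ¬s with prev c c∉A ≟ c
    ... | no prev≢c = pos-≤⇒∈⟨⟩ prev≢c (c-min (prev c c∉A) (prev-∉A c∉A))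
    ... | yes prev≡c = ⊥-elim (¬s (subst Special (sym σc≡c) (loop , coloop)))
      where
      coloop : isColoop π c
      coloop = prev-self⇒coloop c∉A prev≡c
      σc≡c : σ $ₚ c ≡ c
      σc≡c = trans (σ≡π∘prev c∉A) (trans (cong (π $ₚ_) prev≡c) (P.coloop⇒fixed coloop))
      loop : isLoop σ c
      loop = trans (∉A-col c∉A) (cong (if_then c+1 else c0) (dec-true (σ $ₚ c ≟ c) σc≡c))
    k∈S : k ∈S[ π , σ ] (σ $ₚ c)
    k∈S = case special? (σ $ₚ c) of λ where
      (yes s) → inj₁ s
      (no ¬s) → inj₂ (¬s , subst₂ (λ a b → k ∈⟨ a , b ]) (sym π⁻¹σc≡prev) (sym (S.⁻¹-inverseˡ c)) (k∈ ¬s))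

  partition : ShiftIntervalsPartition π σ
  partition = disjoint , cover

lemma3p14 : ∀ {n : ℕ} (σ π : DecPerm n) → suc (rk σ) ≡ rk π →
    (∃ λ (A : Subset n) → IsCyclicShift A π σ) ⇔ ShiftIntervalsPartition π σ
lemma3p14 σ π rank = mk⇔
  (λ (A , shift) → CyclicShiftToPartition.partition σ π σ≉π A shift)
  (λ partition → PartitionToCyclicShift.A σ π rank partition , PartitionToCyclicShift.shift σ π rank partition)
  where
  σ≉π : ¬ σ ≋ π
  σ≉π σ≋π = 1+n≢n (trans rank (sym (rk-cong σ π σ≋π)))
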